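{- Let $G$ be a finite simple graph of order $n(G)$ such that no connected component of $G$ is a complete graph. Then $Z(G)\le n(G)-\gamma_t(G)$.
   Context: Zero forcing: initially a set $S\subseteq V(G)$ is colored blue; the color-change rule colors blue the unique non-blue neighbor of a blue vertex that has exactly one non-blue neighbor, and is applied as long as possible. $S$ is a zero forcing set if eventually all vertices are blue; $Z(G)$ is the minimum cardinality of a zero forcing set. A set $D\subseteq V(G)$ is a total dominating set if every vertex of $G$ has a neighbor in $D$; $\gamma_t(G)$ is the minimum cardinality of such a set. -}

module Defs where

open import Data.Nat using (ℕ)
open import Data.Fin using (Fin)
open import Data.Fin.Subset using (Subset; _∈_; ∣_∣)
open import Data.Product using (∃; _×_)
open import Relation.Nullary using (¬_; Dec)
open import Relation.Binary.PropositionalEquality using (_≡_; _≢_)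
open import Level using (0ℓ)

record Graph (n : ℕ) : Set₁ where
  field
    Adj     : Fin n → Fin n → Set
    adj?    : ∀ u v → Dec (Adj u v)
    sym     : ∀ {u v} → Adj u v → Adj v u
    irrefl  : ∀ {u} → ¬ Adj u u

module _ {n : ℕ} (G : Graph n) where
  open Graph G

  data Reach (u : Fin n) : Fin n → Set where
    here : Reach u u
    step : ∀ {w v} → Reach u w → Adj w v → Reach u v

  ComponentComplete : Fin n → Set
  ComponentComplete v =
    ∀ x y → Reach v x → Reach v y → x ≢ y → Adj x y

  NoCompleteComponent : Set
  NoCompleteComponent = ∀ v → ¬ ComponentComplete v

  -- Blue S v : vertex v is eventually blue when starting from S and
  -- applying the color-change rule as long as possible (the final blue set
  -- is the least set containing S and closed under the rule).
  data Blue (S : Subset n) : Fin n → Set where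
    initial : ∀ {v} → v ∈ S → Blue S v
    force   : ∀ {u v} → Blue S u → Adj u v →
              (∀ w → Adj u w → w ≢ v → Blue S w) → Blue S v

  IsZeroForcingSet : Subset n → Set
  IsZeroForcingSet S = ∀ v → Blue S v

  IsTotalDominatingSet : Subset n → Set
  IsTotalDominatingSet D = ∀ v → ∃ λ u → u ∈ D × Adj v u

-- Build a chain of forces (u , v), each v outside the closed neighbourhood of
-- all earlier forcers. Replaying the chain in order shows that the complement
-- S of the forced vertices is a zero forcing set; the forced vertices are
-- distinct, so |S| = n − #forced ≤ n − #forcers. While some vertex is
-- undominated the chain grows, by a force (x , w) from a neighbour x of a
-- forcer or by two forces (a , b), (b , w) along an induced path a–b–w with
-- b, w undominated; when neither applies, the component of an undominated
-- vertex has no induced P₃ and is therefore complete. Every forcer stays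
-- adjacent to another forcer, so in the end the forcers form a total
-- dominating set and γ_t ≤ #forcers.
module Submission where

open import Defs
open import Data.Nat using (ℕ; zero; suc; _+_; _∸_; _≤_; _<_; z≤n; s≤s)
open import Data.Nat.Properties
  using (≤-refl; ≤-reflexive; ≤-trans; ≤-antisym; n≤1+n; m≤m+n; +-monoʳ-<; ∸-monoʳ-≤; module ≤-Reasoning)
open import Data.Fin using (Fin; zero; suc; _≟_)
open import Data.Fin.Properties using (any?; all?; ¬∀⟶∃¬)
open import Data.Fin.Subset using (Subset; ∣_∣; _∈_; _∉_; _⊆_; ⁅_⁆; _∪_; ∁; ⊥; ⊤; inside; outside)
open import Data.Fin.Subset.Properties
  using (_∈?_; x∈⁅x⁆; x∈⁅y⁆⇒x≡y; x∈p∪q⁻; x∈p∪q⁺; q⊆p∪q; x∉p⇒x∈∁p; ∣∁p∣≡n∸∣p∣; ∣p∣≤n;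
         ∣p∣≡n⇒p≡⊤; ∣p∣≤∣x∷p∣; ∪-identityˡ; p⊂q⇒∣p∣<∣q∣; ∈⊤; ∉⊥; ∣⊥∣≡0)
open import Data.Vec using (_∷_)
open import Data.List using (List; []; _∷_; length)
open import Data.Product using (∃; ∃-syntax; Σ-syntax; _×_; _,_)
open import Data.Sum using (_⊎_; inj₁; inj₂; [_,_]′)
import Data.Sum as Sum
import Data.Unit as Unit
open import Data.Empty using (⊥-elim)
open import Function using (_∘_; id)
open import Relation.Nullary using (¬_; Dec; yes; no)
open import Relation.Nullary.Decidable using (_×-dec_; _⊎-dec_; ¬?; decidable-stable)
open import Relation.Binary.PropositionalEquality using (_≡_; _≢_; refl; sym; subst)

∣⁅x⁆∪p∣≤1+∣p∣ : ∀ {n} (x : Fin n) (p : Subset n) → ∣ ⁅ x ⁆ ∪ p ∣ ≤ suc ∣ p ∣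
∣⁅x⁆∪p∣≤1+∣p∣ zero    (s ∷ p) rewrite ∪-identityˡ p = s≤s (∣p∣≤∣x∷p∣ s p)
∣⁅x⁆∪p∣≤1+∣p∣ (suc x) (inside ∷ p)  = s≤s (∣⁅x⁆∪p∣≤1+∣p∣ x p)
∣⁅x⁆∪p∣≤1+∣p∣ (suc x) (outside ∷ p) = ∣⁅x⁆∪p∣≤1+∣p∣ x p

module _ {n : ℕ} where

  x∈⁅y⁆∪p⁻ : ∀ {x y : Fin n} {p} → x ∈ ⁅ y ⁆ ∪ p → x ≡ y ⊎ x ∈ p
  x∈⁅y⁆∪p⁻ {y = y} {p} = Sum.map₁ (x∈⁅y⁆⇒x≡y y) ∘ x∈p∪q⁻ ⁅ y ⁆ p

  x∈⁅x⁆∪p : ∀ (x : Fin n) {p} → x ∈ ⁅ x ⁆ ∪ p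
  x∈⁅x⁆∪p x = x∈p∪q⁺ (inj₁ (x∈⁅x⁆ x))

  x∈p⇒x∈⁅y⁆∪p : ∀ {x y : Fin n} {p} → x ∈ p → x ∈ ⁅ y ⁆ ∪ p
  x∈p⇒x∈⁅y⁆∪p {y = y} {p} = q⊆p∪q ⁅ y ⁆ p

  x∉p⇒∣p∣<∣⁅x⁆∪p∣ : ∀ {x : Fin n} {p} → x ∉ p → ∣ p ∣ < ∣ ⁅ x ⁆ ∪ p ∣
  x∉p⇒∣p∣<∣⁅x⁆∪p∣ {x} {p} x∉p = p⊂q⇒∣p∣<∣q∣ (q⊆p∪q ⁅ x ⁆ p , x , x∈⁅x⁆∪p x , x∉p)

module _ {n : ℕ} (G : Graph n) where
  open Graph G renaming (sym to Adj-sym)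

  NoInducedP₃ : Fin n → Set
  NoInducedP₃ y = ∀ {a b c} → Reach G y b → Reach G y c → Adj a b → Adj b c → a ≢ c → Adj a c

  noInducedP₃⇒adjacentToRoot : ∀ {y x} → NoInducedP₃ y → Reach G y x → x ≡ y ⊎ Adj y x
  noInducedP₃⇒adjacentToRoot _ here = inj₁ refl
  noInducedP₃⇒adjacentToRoot {y} {x} closes (step r zx) with noInducedP₃⇒adjacentToRoot closes r
  ... | inj₁ refl = inj₂ zx
  ... | inj₂ yz with y ≟ x
  ...   | yes refl = inj₁ refl
  ...   | no y≢x   = inj₂ (closes r (step r zx) yz zx y≢x)

  noInducedP₃⇒ComponentComplete : ∀ {y} → NoInducedP₃ y → ComponentComplete G y
  noInducedP₃⇒ComponentComplete closes x z rx rz x≢z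
    with noInducedP₃⇒adjacentToRoot closes rx | noInducedP₃⇒adjacentToRoot closes rz
  ... | inj₁ refl | inj₁ refl = ⊥-elim (x≢z refl)
  ... | inj₁ refl | inj₂ xz   = xz
  ... | inj₂ yx   | inj₁ refl = Adj-sym yx
  ... | inj₂ yx   | inj₂ yz   = closes here rz (Adj-sym yx) yz x≢z

  TotallyDominated : Subset n → Fin n → Set
  TotallyDominated U y = ∃[ u ] u ∈ U × Adj y u

  Dominated : Subset n → Fin n → Set
  Dominated U y = y ∈ U ⊎ TotallyDominated U y

  dominated? : ∀ U y → Dec (Dominated U y)
  dominated? U y = y ∈? U ⊎-dec any? (λ u → u ∈? U ×-dec adj? y u)

  TotallyDominated-mono : ∀ {U V y} → U ⊆ V → TotallyDominated U y → TotallyDominated V y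
  TotallyDominated-mono U⊆V (u , u∈U , yu) = u , U⊆V u∈U , yu

  Dominated-mono : ∀ {U V y} → U ⊆ V → Dominated U y → Dominated V y
  Dominated-mono U⊆V = Sum.map U⊆V (TotallyDominated-mono U⊆V)

  ¬Dominated-⁅⁆∪ : ∀ {U a w} → a ≢ w → ¬ Adj w a → ¬ Dominated U w → ¬ Dominated (⁅ a ⁆ ∪ U) w
  ¬Dominated-⁅⁆∪ a≢w ¬wa w∉ (inj₁ w∈) with x∈⁅y⁆∪p⁻ w∈
  ... | inj₁ refl = a≢w refl
  ... | inj₂ w∈U  = w∉ (inj₁ w∈U)
  ¬Dominated-⁅⁆∪ a≢w ¬wa w∉ (inj₂ (u , u∈ , wu)) with x∈⁅y⁆∪p⁻ u∈
  ... | inj₁ refl = ¬wa wu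
  ... | inj₂ u∈U  = w∉ (inj₂ (u , u∈U , wu))

  Force : Set
  Force = Fin n × Fin n

  forcers forced : List Force → Subset n
  forcers []             = ⊥
  forcers ((u , _) ∷ fs) = ⁅ u ⁆ ∪ forcers fs
  forced []              = ⊥
  forced ((_ , v) ∷ fs)  = ⁅ v ⁆ ∪ forced fs

  -- Forces are listed newest first.
  IsForcingChain : List Force → Set
  IsForcingChain []             = Unit.⊤
  IsForcingChain ((u , v) ∷ fs) = IsForcingChain fs × Adj u v × ¬ Dominated (forcers fs) v

  forced⇒Dominated : ∀ {fs v} → IsForcingChain fs → v ∈ forced fs → Dominated (forcers fs) v
  forced⇒Dominated {[]} _ v∈⊥ = ⊥-elim (∉⊥ v∈⊥)
  forced⇒Dominated {(u , v) ∷ fs} (chain , uv , _) v∈ with x∈⁅y⁆∪p⁻ v∈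
  ... | inj₁ refl = inj₂ (u , x∈⁅x⁆∪p u , Adj-sym uv)
  ... | inj₂ v∈fs = Dominated-mono x∈p⇒x∈⁅y⁆∪p (forced⇒Dominated chain v∈fs)

  ∣forcers∣≤length : ∀ fs → ∣ forcers fs ∣ ≤ length fs
  ∣forcers∣≤length []             = ≤-reflexive (∣⊥∣≡0 n)
  ∣forcers∣≤length ((u , _) ∷ fs) = ≤-trans (∣⁅x⁆∪p∣≤1+∣p∣ u (forcers fs)) (s≤s (∣forcers∣≤length fs))

  length≤∣forced∣ : ∀ {fs} → IsForcingChain fs → length fs ≤ ∣ forced fs ∣
  length≤∣forced∣ {[]}    _                = z≤n
  length≤∣forced∣ {_ ∷ _} (chain , _ , v∉) =
    ≤-trans (s≤s (length≤∣forced∣ chain)) (x∉p⇒∣p∣<∣⁅x⁆∪p∣ (v∉ ∘ forced⇒Dominated chain))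

  ∣forcers∣≤∣forced∣ : ∀ {fs} → IsForcingChain fs → ∣ forcers fs ∣ ≤ ∣ forced fs ∣
  ∣forcers∣≤∣forced∣ {fs} chain = ≤-trans (∣forcers∣≤length fs) (length≤∣forced∣ chain)

  module _ {fs : List Force} where

    private
      S : Subset n
      S = ∁ (forced fs)

    -- The hypothesis on gs is what holds for every suffix of the chain fs:
    -- a vertex dominated by the forcers of gs is never forced after gs.
    forced-Blue : ∀ gs → IsForcingChain gs →
      (∀ {w} → Dominated (forcers gs) w → w ∈ forced fs → w ∈ forced gs) →
      ∀ {y} → y ∈ forced gs → Blue G S y
    forced-Blue []             _                _     = ⊥-elim ∘ ∉⊥
    forced-Blue ((u , v) ∷ gs) (chain , uv , v∉) fresh =
      [ (λ { refl → force (nearBlue (inj₁ (x∈⁅x⁆∪p u)) λ { refl → irrefl uv }) uv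
                          (λ w uw → nearBlue (inj₂ (u , x∈⁅x⁆∪p u , Adj-sym uw))) })
      , forced-Blue gs chain fresh′ ]′ ∘ x∈⁅y⁆∪p⁻
      where
      fresh′ : ∀ {w} → Dominated (forcers gs) w → w ∈ forced fs → w ∈ forced gs
      fresh′ dom w∈ with x∈⁅y⁆∪p⁻ (fresh (Dominated-mono x∈p⇒x∈⁅y⁆∪p dom) w∈)
      ... | inj₁ refl = ⊥-elim (v∉ dom)
      ... | inj₂ w∈gs = w∈gs
      nearBlue : ∀ {w} → Dominated (forcers ((u , v) ∷ gs)) w → w ≢ v → Blue G S w
      nearBlue {w} dom w≢v with w ∈? forced fs
      ... | no w∉  = initial (x∉p⇒x∈∁p w∉)
      ... | yes w∈ with x∈⁅y⁆∪p⁻ (fresh dom w∈)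
      ...   | inj₁ w≡v  = ⊥-elim (w≢v w≡v)
      ...   | inj₂ w∈gs = forced-Blue gs chain fresh′ w∈gs

    ∁forced-isZeroForcing : IsForcingChain fs → IsZeroForcingSet G S
    ∁forced-isZeroForcing chain y with y ∈? forced fs
    ... | yes y∈ = forced-Blue fs chain (λ _ w∈ → w∈) y∈
    ... | no y∉  = initial (x∉p⇒x∈∁p y∉)

  record ForcingChain : Set where
    field
      forces            : List Force
      isForcingChain    : IsForcingChain forces
      forcers-totallyDominated : ∀ {u} → u ∈ forcers forces → TotallyDominated (forcers forces) u

  open ForcingChain

  forcersOf : ForcingChain → Subset n
  forcersOf c = forcers (forces c)

  emptyChain : ForcingChain
  emptyChain = record
    { forces                   = []
    ; isForcingChain           = _
    ; forcers-totallyDominated = ⊥-elim ∘ ∉⊥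
    }

  module _ (F : Subset n) where

    CanForceFromNeighbour : Set
    CanForceFromNeighbour = ∃[ x ] ∃[ w ] TotallyDominated F x × Adj x w × ¬ Dominated F w

    CanForceAlongPath : Set
    CanForceAlongPath = ∃[ a ] ∃[ b ] ∃[ w ]
      Adj a b × Adj b w × ¬ Dominated F b × ¬ Dominated F w × a ≢ w × ¬ Adj a w

    canForceFromNeighbour? : Dec CanForceFromNeighbour
    canForceFromNeighbour? = any? λ x → any? λ w →
      any? (λ u → u ∈? F ×-dec adj? x u) ×-dec adj? x w ×-dec ¬? (dominated? F w)

    canForceAlongPath? : Dec CanForceAlongPath
    canForceAlongPath? = any? λ a → any? λ b → any? λ w →
      adj? a b ×-dec adj? b w ×-dec ¬? (dominated? F b) ×-dec ¬? (dominated? F w) ×-dec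
      ¬? (a ≟ w) ×-dec ¬? (adj? a w)

    ¬Dominated-reach : ¬ CanForceFromNeighbour → ∀ {y x} →
      ¬ Dominated F y → Reach G y x → ¬ Dominated F x
    ¬Dominated-reach stuck y∉ here = y∉
    ¬Dominated-reach stuck y∉ (step {w = z} {v = x} r zx) (inj₁ x∈F) =
      ¬Dominated-reach stuck y∉ r (inj₂ (x , x∈F , zx))
    ¬Dominated-reach stuck y∉ (step {w = z} {v = x} r zx) (inj₂ x-total) =
      stuck (x , z , x-total , Adj-sym zx , ¬Dominated-reach stuck y∉ r)

    stuck⇒ComponentComplete : ¬ CanForceFromNeighbour → ¬ CanForceAlongPath →
      ∀ {y} → ¬ Dominated F y → ComponentComplete G y
    stuck⇒ComponentComplete stuck₁ stuck₂ y∉ = noInducedP₃⇒ComponentComplete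
      λ {a} {b} {c} rb rc ab bc a≢c → decidable-stable (adj? a c) λ ¬ac →
        stuck₂ (a , b , c , ab , bc , ¬Dominated-reach stuck₁ y∉ rb , ¬Dominated-reach stuck₁ y∉ rc ,
                a≢c , ¬ac)

  extendFromNeighbour : (c : ForcingChain) → CanForceFromNeighbour (forcersOf c) → ForcingChain
  extendFromNeighbour c (x , w , (u , u∈ , xu) , xw , w∉) = record
    { forces                   = (x , w) ∷ forces c
    ; isForcingChain           = isForcingChain c , xw , w∉
    ; forcers-totallyDominated = totallyDominated
    }
    where
    totallyDominated : ∀ {v} → v ∈ ⁅ x ⁆ ∪ forcersOf c → TotallyDominated (⁅ x ⁆ ∪ forcersOf c) v
    totallyDominated v∈ with x∈⁅y⁆∪p⁻ v∈
    ... | inj₁ refl = u , x∈p⇒x∈⁅y⁆∪p u∈ , xu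
    ... | inj₂ v∈F  = TotallyDominated-mono x∈p⇒x∈⁅y⁆∪p (forcers-totallyDominated c v∈F)

  extendAlongPath : (c : ForcingChain) → CanForceAlongPath (forcersOf c) → ForcingChain
  extendAlongPath c (a , b , w , ab , bw , b∉ , w∉ , a≢w , ¬aw) = record
    { forces                   = (b , w) ∷ (a , b) ∷ forces c
    ; isForcingChain           = (isForcingChain c , ab , b∉) , bw , ¬Dominated-⁅⁆∪ a≢w (¬aw ∘ Adj-sym) w∉
    ; forcers-totallyDominated = totallyDominated
    }
    where
    totallyDominated : ∀ {v} → v ∈ ⁅ b ⁆ ∪ (⁅ a ⁆ ∪ forcersOf c) →
      TotallyDominated (⁅ b ⁆ ∪ (⁅ a ⁆ ∪ forcersOf c)) v
    totallyDominated v∈ with x∈⁅y⁆∪p⁻ v∈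
    ... | inj₁ refl = a , x∈p⇒x∈⁅y⁆∪p (x∈⁅x⁆∪p a) , Adj-sym ab
    ... | inj₂ v∈′ with x∈⁅y⁆∪p⁻ v∈′
    ...   | inj₁ refl = b , x∈⁅x⁆∪p b , ab
    ...   | inj₂ v∈F  = TotallyDominated-mono (x∈p⇒x∈⁅y⁆∪p ∘ x∈p⇒x∈⁅y⁆∪p) (forcers-totallyDominated c v∈F)

  extend : NoCompleteComponent G → (c : ForcingChain) → ∃[ y ] ¬ Dominated (forcersOf c) y →
    Σ[ c′ ∈ ForcingChain ] length (forces c) < length (forces c′)
  extend ncc c (y , y∉)
    with canForceFromNeighbour? (forcersOf c) | canForceAlongPath? (forcersOf c)
  ... | yes next  | _         = extendFromNeighbour c next , ≤-refl
  ... | no _      | yes next  = extendAlongPath c next , n≤1+n _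
  ... | no stuck₁ | no stuck₂ = ⊥-elim (ncc y (stuck⇒ComponentComplete _ stuck₁ stuck₂ y∉))

  -- The fuel k suffices because a forcing chain has at most n forces.
  dominatingChain : NoCompleteComponent G → ∀ k (c : ForcingChain) → n ≤ k + length (forces c) →
    Σ[ c ∈ ForcingChain ] (∀ y → Dominated (forcersOf c) y)
  dominatingChain ncc zero c n≤length =
    c , λ y → forced⇒Dominated (isForcingChain c) (subst (y ∈_) (sym forced≡⊤) ∈⊤)
    where
    forced≡⊤ : forced (forces c) ≡ ⊤
    forced≡⊤ = ∣p∣≡n⇒p≡⊤ (≤-antisym (∣p∣≤n (forced (forces c)))
                                    (≤-trans n≤length (length≤∣forced∣ (isForcingChain c))))
  dominatingChain ncc (suc k) c n≤ with all? (dominated? (forcersOf c))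
  ... | yes dominating = c , dominating
  ... | no ¬dominating with extend ncc c (¬∀⟶∃¬ n _ (dominated? _) ¬dominating)
  ...   | c′ , longer = dominatingChain ncc k c′ (≤-trans n≤ (+-monoʳ-< k longer))

  forcers-isTotalDominating : (c : ForcingChain) → (∀ y → Dominated (forcersOf c) y) →
    IsTotalDominatingSet G (forcersOf c)
  forcers-isTotalDominating c dominating y = [ forcers-totallyDominated c , id ]′ (dominating y)

corollary3p3 : (n : ℕ) (G : Graph n) → NoCompleteComponent G →
    (D : Subset n) → IsTotalDominatingSet G D →
    (∀ D′ → IsTotalDominatingSet G D′ → ∣ D ∣ ≤ ∣ D′ ∣) →
    ∃ λ (S : Subset n) → IsZeroForcingSet G S × ∣ S ∣ ≤ n ∸ ∣ D ∣
corollary3p3 n G ncc D _ D-minimum with dominatingChain G ncc n (emptyChain G) (m≤m+n n 0)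
... | c , dominating = ∁ (forced G fs) , ∁forced-isZeroForcing G chain , ∣S∣≤n∸∣D∣
  where
  open ForcingChain c renaming (forces to fs; isForcingChain to chain)
  open ≤-Reasoning
  ∣S∣≤n∸∣D∣ : ∣ ∁ (forced G fs) ∣ ≤ n ∸ ∣ D ∣
  ∣S∣≤n∸∣D∣ = begin
    ∣ ∁ (forced G fs) ∣  ≡⟨ ∣∁p∣≡n∸∣p∣ (forced G fs) ⟩
    n ∸ ∣ forced G fs ∣  ≤⟨ ∸-monoʳ-≤ n (begin
      ∣ D ∣               ≤⟨ D-minimum _ (forcers-isTotalDominating G c dominating) ⟩
      ∣ forcers G fs ∣    ≤⟨ ∣forcers∣≤∣forced∣ G chain ⟩
      ∣ forced G fs ∣     ∎) ⟩
    n ∸ ∣ D ∣            ∎
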